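{- Let $n$ be a composite integer which is not the square of a prime, and let $n=p_1^{\alpha_1}p_2^{\alpha_2}\cdots p_k^{\alpha_k}$ be its prime power factorization, ordered so that $\alpha_1,\dots,\alpha_l$ are odd and $\alpha_{l+1},\dots,\alpha_k$ are even, for some $l\in\{0,1,\dots,k\}$. Then the clique number of $\Upsilon_n$ is $$\omega(\Upsilon_n)=\left\lceil\tfrac{\alpha_1}{2}\right\rceil\left\lceil\tfrac{\alpha_2}{2}\right\rceil\cdots\left\lceil\tfrac{\alpha_l}{2}\right\rceil\left(\tfrac{\alpha_{l+1}}{2}+1\right)\cdots\left(\tfrac{\alpha_k}{2}+1\right)+l-1.$$
   Context: For an integer $n>1$, a proper divisor of $n$ is an integer $d$ with $1<d<n$ and $d\mid n$. The proper divisor graph $\Upsilon_n$ is the simple graph whose vertices are the proper divisors of $n$, two distinct vertices $u,v$ being adjacent iff $n\mid uv$. The clique number is the maximum size of a set of pairwise adjacent vertices. -}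

module Defs where

open import Data.Nat.Base using (ℕ; zero; suc; _+_; _*_; _^_; _<_; _≤_; ⌈_/2⌉; ⌊_/2⌋; _<ᵇ_)
open import Data.Bool.Base using (if_then_else_)
open import Data.Nat.Divisibility using (_∣_)
open import Data.Fin.Base using (Fin; toℕ) renaming (zero to fzero; suc to fsuc)
open import Data.List.Base using (List; length)
open import Data.List.Relation.Unary.All using (All)
open import Data.List.Relation.Unary.AllPairs using (AllPairs)
open import Data.Product.Base using (_×_; Σ)
open import Relation.Binary.PropositionalEquality using (_≡_; _≢_)

ProperDivisor : ℕ → ℕ → Set
ProperDivisor n d = 1 < d × d < n × d ∣ n

Adjacent : ℕ → ℕ → ℕ → Set
Adjacent n u v = u ≢ v × n ∣ u * v

IsClique : ℕ → List ℕ → Set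
IsClique n S = All (ProperDivisor n) S × AllPairs (Adjacent n) S

CliqueNumber : ℕ → ℕ → Set
CliqueNumber n ω = Σ (List ℕ) (λ S → IsClique n S × length S ≡ ω) × (∀ S → IsClique n S → length S ≤ ω)

prod : (k : ℕ) → (Fin k → ℕ) → ℕ
prod zero f = 1
prod (suc k) f = f fzero * prod k (λ i → f (fsuc i))

factor : (k l : ℕ) → (Fin k → ℕ) → Fin k → ℕ
factor k l α i = if toℕ i <ᵇ l then ⌈ α i /2⌉ else ⌊ α i /2⌋ + 1

module Submission where

-- Divisors of n = ∏ pᵢ^αᵢ are the exponent vectors e ≤ α, and two of them are adjacent exactly
-- when they differ and e + f ≥ α coordinatewise.  The vectors with every eᵢ ≥ ⌈αᵢ/2⌉ form a box
-- with ∏ (⌊αᵢ/2⌋ + 1) elements and are pairwise adjacent; dropping α itself and adding, for each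
-- odd αᵢ, the vector α with its i-th coordinate lowered to ⌊αᵢ/2⌋ gives a clique of the stated
-- size.  Conversely, extend a clique by α and send each member lying in the box to itself; any
-- other member has a coordinate i with eᵢ < ⌈αᵢ/2⌉ and is sent to i when αᵢ is odd and to the
-- lowered vector at i when αᵢ is even.  Two adjacent vectors cannot both be small in the same
-- coordinate, and a vector small at i is not adjacent to the lowered vector at i, so adjacent
-- vectors have distinct images and the clique plus α has at most |box| + l elements.

open import Defs
open import Data.Nat.Base
open import Data.Nat.Properties
open import Data.Nat.Divisibility
open import Data.Nat.Primality
  using (Prime; Composite; composite; euclidsLemma; prime⇒irreducible; prime⇒nonZero
        ; composite⇒nonZero; ¬prime[1])
open import Data.Nat.Coprimality using (Coprime; coprime-divisor)
open import Data.Bool.Base using (true; false; T)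
open import Data.Fin.Base using (Fin; toℕ; fromℕ<; inject≤) renaming (zero to fzero; suc to fsuc)
import Data.Fin.Properties as Finₚ
open import Data.Vec.Base using (Vec; []; _∷_; lookup; tabulate; replicate; _[_]≔_)
import Data.Vec.Properties as Vecₚ
open import Data.Vec.Relation.Binary.Pointwise.Extensional using (ext; Pointwise-≡⇒≡)
open import Data.List.Base as List
  using (List; []; _∷_; [_]; length; map; _++_; downFrom; cartesianProductWith; allFin)
import Data.List.Properties as Listₚ
open import Data.List.Membership.Propositional using (_∈_)
open import Data.List.Membership.Propositional.Properties
open import Data.List.Relation.Unary.Any using (here; there; _─_)
open import Data.List.Relation.Unary.All as All using (All; []; _∷_)
import Data.List.Relation.Unary.All.Properties as Allₚ
open import Data.List.Relation.Unary.AllPairs as AllPairs using (AllPairs; []; _∷_)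
import Data.List.Relation.Unary.AllPairs.Properties as AllPairsₚ
open import Data.List.Relation.Unary.Unique.Propositional using (Unique)
import Data.List.Relation.Unary.Unique.Propositional.Properties as Uniqueₚ
open import Data.List.Relation.Binary.Disjoint.Propositional using (Disjoint)
open import Data.Product.Base using (_×_; ∃; ∃-syntax; _,_; proj₁; proj₂)
open import Data.Sum.Base using (_⊎_; inj₁; inj₂)
open import Data.Sum.Properties using (inj₁-injective; inj₂-injective)
open import Function.Base using (_∘_)
open import Function.Definitions using (Injective)
open import Relation.Binary.PropositionalEquality
  using (_≡_; _≢_; refl; sym; trans; cong; cong₂; subst; subst₂; module ≡-Reasoning)
open import Relation.Nullary using (¬_; Dec; yes; no; contradiction)

-- Products of prime powers

prod-cong : ∀ k {f g : Fin k → ℕ} → (∀ i → f i ≡ g i) → prod k f ≡ prod k g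
prod-cong zero    f≡g = refl
prod-cong (suc k) f≡g = cong₂ _*_ (f≡g fzero) (prod-cong k (f≡g ∘ fsuc))

prod-* : ∀ k (f g : Fin k → ℕ) → prod k (λ i → f i * g i) ≡ prod k f * prod k g
prod-* zero    f g = refl
prod-* (suc k) f g = trans (cong (f fzero * g fzero *_) (prod-* k (f ∘ fsuc) (g ∘ fsuc)))
  ([m*n]*[o*p]≡[m*o]*[n*p] (f fzero) (g fzero) (prod k (f ∘ fsuc)) (prod k (g ∘ fsuc)))

prod-∣ : ∀ k {f g : Fin k → ℕ} → (∀ i → f i ∣ g i) → prod k f ∣ prod k g
prod-∣ zero    f∣g = ∣-refl
prod-∣ (suc k) f∣g = *-pres-∣ (f∣g fzero) (prod-∣ k (f∣g ∘ fsuc))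

powProd : ∀ {k} → (Fin k → ℕ) → (Fin k → ℕ) → ℕ
powProd {k} p e = prod k (λ i → p i ^ e i)

powProd-zero : ∀ {k} (p : Fin k → ℕ) → powProd p (λ _ → 0) ≡ 1
powProd-zero {zero}  p = refl
powProd-zero {suc k} p = trans (+-identityʳ _) (powProd-zero (p ∘ fsuc))

powProd-+ : ∀ {k} (p a b : Fin k → ℕ) → powProd p (λ i → a i + b i) ≡ powProd p a * powProd p b
powProd-+ {k} p a b = trans (prod-cong k (λ i → ^-distribˡ-+-* (p i) (a i) (b i)))
  (prod-* k (λ i → p i ^ a i) (λ i → p i ^ b i))

^-monoʳ-∣ : ∀ m {a b} → a ≤ b → m ^ a ∣ m ^ b
^-monoʳ-∣ m {a} {b} a≤b = divides (m ^ (b ∸ a)) (begin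
  m ^ b               ≡⟨ cong (m ^_) (m+[n∸m]≡n a≤b) ⟨
  m ^ (a + (b ∸ a))   ≡⟨ ^-distribˡ-+-* m a (b ∸ a) ⟩
  m ^ a * m ^ (b ∸ a) ≡⟨ *-comm (m ^ a) _ ⟩
  m ^ (b ∸ a) * m ^ a ∎)
  where open ≡-Reasoning

powProd-monoʳ-∣ : ∀ {k} (p : Fin k → ℕ) {a b} → (∀ i → a i ≤ b i) → powProd p a ∣ powProd p b
powProd-monoʳ-∣ {k} p a≤b = prod-∣ k (λ i → ^-monoʳ-∣ (p i) (a≤b i))

prime∤1 : ∀ {p} → Prime p → ¬ p ∣ 1
prime∤1 pp p∣1 = ¬prime[1] (subst Prime (∣1⇒≡1 p∣1) pp)

prime∤prime^ : ∀ {q r} → Prime q → Prime r → q ≢ r → ∀ e → ¬ q ∣ r ^ e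
prime∤prime^ pq pr q≢r zero    = prime∤1 pq
prime∤prime^ pq pr q≢r (suc e) q∣r^1+e with euclidsLemma _ _ pq q∣r^1+e
... | inj₂ q∣r^e = prime∤prime^ pq pr q≢r e q∣r^e
... | inj₁ q∣r with prime⇒irreducible pr q∣r
...   | inj₁ refl = ¬prime[1] pq
...   | inj₂ q≡r  = q≢r q≡r

prime∤powProd : ∀ {k q} (p e : Fin k → ℕ) → Prime q → (∀ i → Prime (p i)) → (∀ i → q ≢ p i) →
                ¬ q ∣ powProd p e
prime∤powProd {zero}  p e pq pp q≢p = prime∤1 pq
prime∤powProd {suc k} p e pq pp q≢p q∣ with euclidsLemma _ _ pq q∣
... | inj₁ q∣head = prime∤prime^ pq (pp fzero) (q≢p fzero) (e fzero) q∣head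
... | inj₂ q∣tail = prime∤powProd (p ∘ fsuc) (e ∘ fsuc) pq (pp ∘ fsuc) (q≢p ∘ fsuc) q∣tail

prime∤⇒coprime : ∀ {p m} → Prime p → ¬ p ∣ m → Coprime m p
prime∤⇒coprime pp p∤m (d∣m , d∣p) with prime⇒irreducible pp d∣p
... | inj₁ d≡1  = d≡1
... | inj₂ refl = contradiction d∣m p∤m

coprime-^-divisor : ∀ {m p o} b → Coprime m p → m ∣ p ^ b * o → m ∣ o
coprime-^-divisor {m} {p} {o} zero    m⊥p m∣ = subst (m ∣_) (*-identityˡ o) m∣
coprime-^-divisor {m} {p} {o} (suc b) m⊥p m∣ =
  coprime-^-divisor b m⊥p (coprime-divisor m⊥p (subst (m ∣_) (*-assoc p (p ^ b) o) m∣))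

p^a∣p^b*m⇒a≤b : ∀ {p m} a b → Prime p → ¬ p ∣ m → p ^ a ∣ p ^ b * m → a ≤ b
p^a∣p^b*m⇒a≤b         zero    b       pp p∤m h = z≤n
p^a∣p^b*m⇒a≤b {p} {m} (suc a) zero    pp p∤m h =
  contradiction (subst (p ∣_) (*-identityˡ m) (m*n∣⇒m∣ p (p ^ a) h)) p∤m
p^a∣p^b*m⇒a≤b {p} {m} (suc a) (suc b) pp p∤m h = s≤s (p^a∣p^b*m⇒a≤b a b pp p∤m
  (*-cancelˡ-∣ p {{prime⇒nonZero pp}} (subst (p * p ^ a ∣_) (*-assoc p (p ^ b) m) h)))

∣p^a*m⇒ : ∀ {p m} a d → Prime p → ¬ p ∣ m → d ∣ p ^ a * m →
          ∃[ e ] ∃[ d′ ] e ≤ a × d′ ∣ m × d ≡ p ^ e * d′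
∣p^a*m⇒ {p} {m} a d pp p∤m d∣ with p ∣? d
... | no p∤d = 0 , d , z≤n , coprime-^-divisor a (prime∤⇒coprime pp p∤d) d∣ , sym (*-identityˡ d)
∣p^a*m⇒ {p} {m} zero    d pp p∤m d∣ | yes p∣d =
  contradiction (subst (p ∣_) (*-identityˡ m) (∣-trans p∣d d∣)) p∤m
∣p^a*m⇒ {p} {m} (suc a) _ pp p∤m d∣ | yes (divides q refl)
  with ∣p^a*m⇒ a q pp p∤m
         (*-cancelˡ-∣ p {{prime⇒nonZero pp}} (subst₂ _∣_ (*-comm q p) (*-assoc p (p ^ a) m) d∣))
... | e , d′ , e≤a , d′∣m , refl =
  suc e , d′ , s≤s e≤a , d′∣m , trans (*-comm _ p) (sym (*-assoc p (p ^ e) d′))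

record DistinctPrimes {k} (p : Fin k → ℕ) : Set where
  field
    prime     : ∀ i → Prime (p i)
    injective : Injective _≡_ _≡_ p

open DistinctPrimes

module _ {k} {p : Fin (suc k) → ℕ} (ps : DistinctPrimes p) where

  DistinctPrimes-tail : DistinctPrimes (p ∘ fsuc)
  DistinctPrimes-tail = record
    { prime     = prime ps ∘ fsuc
    ; injective = Finₚ.suc-injective ∘ injective ps
    }

  head∤powProd-tail : ∀ e → ¬ p fzero ∣ powProd (p ∘ fsuc) e
  head∤powProd-tail e =
    prime∤powProd (p ∘ fsuc) e (prime ps fzero) (prime ps ∘ fsuc) (λ _ → Finₚ.0≢1+n ∘ injective ps)

powProd-∣⇒≤ : ∀ {k} {p : Fin k → ℕ} → DistinctPrimes p →
              ∀ a b → powProd p a ∣ powProd p b → ∀ i → a i ≤ b i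
powProd-∣⇒≤ ps a b a∣b fzero = p^a∣p^b*m⇒a≤b (a fzero) (b fzero) (prime ps fzero)
  (head∤powProd-tail ps (b ∘ fsuc)) (∣-trans (m∣m*n _) a∣b)
powProd-∣⇒≤ {p = p} ps a b a∣b (fsuc i) =
  powProd-∣⇒≤ (DistinctPrimes-tail ps) (a ∘ fsuc) (b ∘ fsuc) tail∣tail i
  where
  tail∣tail : powProd (p ∘ fsuc) (a ∘ fsuc) ∣ powProd (p ∘ fsuc) (b ∘ fsuc)
  tail∣tail = coprime-^-divisor (b fzero)
    (prime∤⇒coprime (prime ps fzero) (head∤powProd-tail ps (a ∘ fsuc)))
    (∣-trans (n∣m*n (p fzero ^ a fzero)) a∣b)

∣powProd⇒ : ∀ {k} {p : Fin k → ℕ} → DistinctPrimes p → ∀ α d → d ∣ powProd p α →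
            ∃[ e ] (∀ i → lookup e i ≤ α i) × d ≡ powProd p (lookup e)
∣powProd⇒ {zero}  ps α d d∣1 = [] , (λ ()) , ∣1⇒≡1 d∣1
∣powProd⇒ {suc k} ps α d d∣
  with ∣p^a*m⇒ (α fzero) d (prime ps fzero) (head∤powProd-tail ps (α ∘ fsuc)) d∣
... | e₀ , d′ , e₀≤ , d′∣ , refl with ∣powProd⇒ (DistinctPrimes-tail ps) (α ∘ fsuc) d′ d′∣
... | e , e≤ , refl = e₀ ∷ e , (λ { fzero → e₀≤ ; (fsuc i) → e≤ i }) , refl

module _ {A : Set} where

  ∈-─⁺ : ∀ {x z : A} {ys} (x∈ys : x ∈ ys) → z ∈ ys → z ≢ x → z ∈ (ys ─ x∈ys)
  ∈-─⁺ (here refl)  (here refl)  z≢x = contradiction refl z≢x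
  ∈-─⁺ (here refl)  (there z∈ys) z≢x = z∈ys
  ∈-─⁺ (there x∈ys) (here z≡y)   z≢x = here z≡y
  ∈-─⁺ (there x∈ys) (there z∈ys) z≢x = there (∈-─⁺ x∈ys z∈ys z≢x)

  Unique-⊆⇒length-≤ : ∀ {xs ys : List A} → Unique xs → (∀ {x} → x ∈ xs → x ∈ ys) →
                      length xs ≤ length ys
  Unique-⊆⇒length-≤ {[]}          _            _     = z≤n
  Unique-⊆⇒length-≤ {x ∷ xs} {ys} (x∉xs ∷ xs!) xs⊆ys = begin
    suc (length xs)          ≤⟨ s≤s (Unique-⊆⇒length-≤ xs! xs⊆ys─x) ⟩
    suc (length (ys ─ x∈ys)) ≡⟨ Listₚ.length-removeAt′ ys _ ⟨
    length ys                ∎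
    where
    open ≤-Reasoning
    x∈ys = xs⊆ys (here refl)
    xs⊆ys─x : ∀ {z} → z ∈ xs → z ∈ (ys ─ x∈ys)
    xs⊆ys─x z∈xs = ∈-─⁺ x∈ys (xs⊆ys (there z∈xs)) (All.lookup x∉xs z∈xs ∘ sym)

  All⇒AllPairs : ∀ {P : A → Set} {R : A → A → Set} → (∀ {x y} → P x → P y → R x y) →
                 ∀ {xs} → All P xs → AllPairs R xs
  All⇒AllPairs f []         = []
  All⇒AllPairs f (px ∷ pxs) = All.map (f px) pxs ∷ All⇒AllPairs f pxs

module _ {A B : Set} {P : A → Set} (f : A → B) where

  All-preimage : ∀ {ys} → All (λ y → ∃[ x ] P x × y ≡ f x) ys → ∃[ xs ] All P xs × map f xs ≡ ys
  All-preimage []                       = [] , [] , refl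
  All-preimage ((x , px , refl) ∷ rest) with All-preimage rest
  ... | xs , pxs , refl = x ∷ xs , px ∷ pxs , refl

length-cartesianProductWith : ∀ {A B C : Set} (f : A → B → C) xs ys →
  length (cartesianProductWith f xs ys) ≡ length xs * length ys
length-cartesianProductWith f []       ys = refl
length-cartesianProductWith f (x ∷ xs) ys = trans (Listₚ.length-++ (map (f x) ys))
  (cong₂ _+_ (Listₚ.length-map (f x) ys) (length-cartesianProductWith f xs ys))

-- Boxes of vectors

-- Listed from b down to a, so that every box begins with its top corner (box-head).
range : ℕ → ℕ → List ℕ
range a b = map (a +_) (downFrom (suc (b ∸ a)))

box : ∀ {k} → (lo hi : Fin k → ℕ) → List (Vec ℕ k)
box {zero}  lo hi = [ [] ]
box {suc k} lo hi =
  cartesianProductWith _∷_ (range (lo fzero) (hi fzero)) (box (lo ∘ fsuc) (hi ∘ fsuc))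

InBox : ∀ {k} → (lo hi : Fin k → ℕ) → Vec ℕ k → Set
InBox lo hi e = ∀ i → lo i ≤ lookup e i × lookup e i ≤ hi i

length-range : ∀ a b → length (range a b) ≡ suc (b ∸ a)
length-range a b =
  trans (Listₚ.length-map (a +_) (downFrom (suc (b ∸ a)))) (Listₚ.length-downFrom (suc (b ∸ a)))

length-box : ∀ {k} (lo hi : Fin k → ℕ) → length (box lo hi) ≡ prod k (λ i → suc (hi i ∸ lo i))
length-box {zero}  lo hi = refl
length-box {suc k} lo hi =
  trans (length-cartesianProductWith _∷_ (range (lo fzero) (hi fzero)) (box (lo ∘ fsuc) (hi ∘ fsuc)))
    (cong₂ _*_ (length-range (lo fzero) (hi fzero)) (length-box (lo ∘ fsuc) (hi ∘ fsuc)))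

∈-range⁺ : ∀ {a b x} → a ≤ x → x ≤ b → x ∈ range a b
∈-range⁺ {a} {b} a≤x x≤b = subst (_∈ range a b) (m+[n∸m]≡n a≤x)
  (∈-map⁺ (a +_) (∈-downFrom⁺ (s≤s (∸-monoˡ-≤ a x≤b))))

∈-range⁻ : ∀ {a b x} → a ≤ b → x ∈ range a b → a ≤ x × x ≤ b
∈-range⁻ {a} {b} a≤b x∈ with ∈-map⁻ (a +_) x∈
... | y , y∈ , refl =
  m≤m+n a y , subst (a + y ≤_) (m+[n∸m]≡n a≤b) (+-monoʳ-≤ a (s≤s⁻¹ (∈-downFrom⁻ y∈)))

∈-box⁺ : ∀ {k} {lo hi : Fin k → ℕ} {e} → InBox lo hi e → e ∈ box lo hi
∈-box⁺ {e = []}    e∈ = here refl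
∈-box⁺ {e = x ∷ e} e∈ = ∈-cartesianProductWith⁺ _∷_
  (∈-range⁺ (proj₁ (e∈ fzero)) (proj₂ (e∈ fzero))) (∈-box⁺ (e∈ ∘ fsuc))

∈-box⁻ : ∀ {k} {lo hi : Fin k → ℕ} → (∀ i → lo i ≤ hi i) → ∀ {e} → e ∈ box lo hi → InBox lo hi e
∈-box⁻ {zero}  lo≤hi {[]} _ ()
∈-box⁻ {suc k} {lo} {hi} lo≤hi e∈
  with ∈-cartesianProductWith⁻ _∷_ (range (lo fzero) (hi fzero)) (box (lo ∘ fsuc) (hi ∘ fsuc)) e∈
... | x , e , x∈ , e∈′ , refl = λ where
  fzero    → ∈-range⁻ (lo≤hi fzero) x∈
  (fsuc i) → ∈-box⁻ (lo≤hi ∘ fsuc) e∈′ i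

range-unique : ∀ a b → Unique (range a b)
range-unique a b = Uniqueₚ.map⁺ (+-cancelˡ-≡ a _ _) (Uniqueₚ.downFrom⁺ _)

box-unique : ∀ {k} (lo hi : Fin k → ℕ) → Unique (box lo hi)
box-unique {zero}  lo hi = [] ∷ []
box-unique {suc k} lo hi = Uniqueₚ.cartesianProductWith⁺ _∷_ Vecₚ.∷-injective
  (range-unique (lo fzero) (hi fzero)) (box-unique (lo ∘ fsuc) (hi ∘ fsuc))

box-head : ∀ {k} (lo hi : Fin k → ℕ) → (∀ i → lo i ≤ hi i) → ∃[ rest ] box lo hi ≡ tabulate hi ∷ rest
box-head {zero}  lo hi lo≤hi = [] , refl
box-head {suc k} lo hi lo≤hi with box-head (lo ∘ fsuc) (hi ∘ fsuc) (lo≤hi ∘ fsuc)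
... | rest , eq rewrite eq | m+[n∸m]≡n (lo≤hi fzero) = _ , refl

0<n⇒⌊n/2⌋<n : ∀ {n} → 0 < n → ⌊ n /2⌋ < n
0<n⇒⌊n/2⌋<n {suc n} _ = ⌊n/2⌋<n n

⌈n/2⌉≤1+⌊n/2⌋ : ∀ n → ⌈ n /2⌉ ≤ suc ⌊ n /2⌋
⌈n/2⌉≤1+⌊n/2⌋ zero          = z≤n
⌈n/2⌉≤1+⌊n/2⌋ (suc zero)    = ≤-refl
⌈n/2⌉≤1+⌊n/2⌋ (suc (suc n)) = s≤s (⌈n/2⌉≤1+⌊n/2⌋ n)

n≤⌈n/2⌉+⌈n/2⌉ : ∀ n → n ≤ ⌈ n /2⌉ + ⌈ n /2⌉
n≤⌈n/2⌉+⌈n/2⌉ n =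
  subst (_≤ ⌈ n /2⌉ + ⌈ n /2⌉) (⌊n/2⌋+⌈n/2⌉≡n n) (+-monoˡ-≤ ⌈ n /2⌉ (⌊n/2⌋≤⌈n/2⌉ n))

even⇒⌈n/2⌉≡⌊n/2⌋ : ∀ n → 2 ∣ n → ⌈ n /2⌉ ≡ ⌊ n /2⌋
even⇒⌈n/2⌉≡⌊n/2⌋ zero          _     = refl
even⇒⌈n/2⌉≡⌊n/2⌋ (suc zero)    2∣1   = contradiction (∣1⇒≡1 2∣1) λ ()
even⇒⌈n/2⌉≡⌊n/2⌋ (suc (suc n)) 2∣2+n = cong suc (even⇒⌈n/2⌉≡⌊n/2⌋ n (∣m+n∣m⇒∣n 2∣2+n ∣-refl))

odd⇒⌈n/2⌉≡1+⌊n/2⌋ : ∀ n → ¬ 2 ∣ n → ⌈ n /2⌉ ≡ suc ⌊ n /2⌋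
odd⇒⌈n/2⌉≡1+⌊n/2⌋ zero          2∤0   = contradiction (2 ∣0) 2∤0
odd⇒⌈n/2⌉≡1+⌊n/2⌋ (suc zero)    _     = refl
odd⇒⌈n/2⌉≡1+⌊n/2⌋ (suc (suc n)) 2∤2+n = cong suc (odd⇒⌈n/2⌉≡1+⌊n/2⌋ n (2∤2+n ∘ ∣m∣n⇒∣m+n ∣-refl))

odd⇒⌊n/2⌋<⌈n/2⌉ : ∀ n → ¬ 2 ∣ n → ⌊ n /2⌋ < ⌈ n /2⌉
odd⇒⌊n/2⌋<⌈n/2⌉ n 2∤n = ≤-reflexive (sym (odd⇒⌈n/2⌉≡1+⌊n/2⌋ n 2∤n))

<⌈/2⌉∧≤+⇒⌊/2⌋< : ∀ {a u v} → u < ⌈ a /2⌉ → a ≤ u + v → ⌊ a /2⌋ < v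
<⌈/2⌉∧≤+⇒⌊/2⌋< {a} {u} {v} u<⌈a/2⌉ a≤u+v = +-cancelʳ-< ⌈ a /2⌉ ⌊ a /2⌋ v (begin-strict
  ⌊ a /2⌋ + ⌈ a /2⌉ ≡⟨ ⌊n/2⌋+⌈n/2⌉≡n a ⟩
  a                 ≤⟨ a≤u+v ⟩
  u + v             <⟨ +-monoˡ-< v u<⌈a/2⌉ ⟩
  ⌈ a /2⌉ + v       ≡⟨ +-comm ⌈ a /2⌉ v ⟩
  v + ⌈ a /2⌉       ∎)
  where open ≤-Reasoning

⌈/2⌉≤⇒≤+⌊/2⌋ : ∀ {a x} → ⌈ a /2⌉ ≤ x → a ≤ x + ⌊ a /2⌋
⌈/2⌉≤⇒≤+⌊/2⌋ {a} {x} ⌈a/2⌉≤x = begin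
  a                 ≡⟨ ⌊n/2⌋+⌈n/2⌉≡n a ⟨
  ⌊ a /2⌋ + ⌈ a /2⌉ ≤⟨ +-monoʳ-≤ ⌊ a /2⌋ ⌈a/2⌉≤x ⟩
  ⌊ a /2⌋ + x       ≡⟨ +-comm ⌊ a /2⌋ x ⟩
  x + ⌊ a /2⌋       ∎
  where open ≤-Reasoning

-- Exponent vectors

module ExponentVectors {k} (α : Fin k → ℕ) where

  top : Vec ℕ k
  top = tabulate α

  bottom : Vec ℕ k
  bottom = replicate k 0

  Below : Vec ℕ k → Set
  Below e = ∀ i → lookup e i ≤ α i

  Proper : Vec ℕ k → Set
  Proper e = Below e × e ≢ bottom × e ≢ top

  Complementary : Vec ℕ k → Vec ℕ k → Set
  Complementary u v = ∀ i → α i ≤ lookup u i + lookup v i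

  Joined : Vec ℕ k → Vec ℕ k → Set
  Joined u v = u ≢ v × Complementary u v

  IsProperClique : List (Vec ℕ k) → Set
  IsProperClique C = All Proper C × AllPairs Joined C

  Large : Vec ℕ k → Set
  Large = InBox (λ i → ⌈ α i /2⌉) α

  upperHalf : List (Vec ℕ k)
  upperHalf = box (λ i → ⌈ α i /2⌉) α

  lowered : Fin k → Vec ℕ k
  lowered i = top [ i ]≔ ⌊ α i /2⌋

  ≡-by-lookup : ∀ {u v : Vec ℕ k} → (∀ i → lookup u i ≡ lookup v i) → u ≡ v
  ≡-by-lookup u≗v = Pointwise-≡⇒≡ (ext u≗v)

  lookup-top : ∀ i → lookup top i ≡ α i
  lookup-top = Vecₚ.lookup∘tabulate α

  lookup-lowered : ∀ i → lookup (lowered i) i ≡ ⌊ α i /2⌋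
  lookup-lowered i = Vecₚ.lookup∘update i top _

  lookup-lowered-≢ : ∀ {i j} → j ≢ i → lookup (lowered i) j ≡ α j
  lookup-lowered-≢ {i} {j} j≢i = trans (Vecₚ.lookup∘update′ j≢i top _) (lookup-top j)

  Complementary-sym : ∀ {u v} → Complementary u v → Complementary v u
  Complementary-sym {u} {v} u+v≥α i = subst (α i ≤_) (+-comm (lookup u i) (lookup v i)) (u+v≥α i)

  top-complementary : ∀ e → Complementary top e
  top-complementary e i = subst (_≤ lookup top i + lookup e i) (lookup-top i) (m≤m+n _ _)

  Large⇒Below : ∀ {e} → Large e → Below e
  Large⇒Below e-large = proj₂ ∘ e-large

  Large-complementary : ∀ {u v} → Large u → Large v → Complementary u v
  Large-complementary u-large v-large i =
    ≤-trans (n≤⌈n/2⌉+⌈n/2⌉ (α i)) (+-mono-≤ (proj₁ (u-large i)) (proj₁ (v-large i)))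

  lowered-Below : ∀ i → Below (lowered i)
  lowered-Below i j with j Finₚ.≟ i
  ... | yes refl = subst (_≤ α j) (sym (lookup-lowered j)) (⌊n/2⌋≤n (α j))
  ... | no  j≢i  = ≤-reflexive (lookup-lowered-≢ j≢i)

  Large-lowered-complementary : ∀ {e} i → Large e → Complementary e (lowered i)
  Large-lowered-complementary {e} i e-large j with j Finₚ.≟ i
  ... | yes refl = subst (α j ≤_) (cong (lookup e j +_) (sym (lookup-lowered j)))
                     (⌈/2⌉≤⇒≤+⌊/2⌋ (proj₁ (e-large j)))
  ... | no  j≢i  = subst (α j ≤_) (cong (lookup e j +_) (sym (lookup-lowered-≢ j≢i)))
                     (m≤n+m (α j) _)

  lowered-complementary : ∀ {i j} → i ≢ j → Complementary (lowered i) (lowered j)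
  lowered-complementary {i} {j} i≢j m with m Finₚ.≟ i
  ... | no  m≢i  = subst (α m ≤_) (cong (_+ lookup (lowered j) m) (sym (lookup-lowered-≢ m≢i)))
                     (m≤m+n (α m) _)
  ... | yes refl = subst (α m ≤_) (cong (lookup (lowered m) m +_) (sym (lookup-lowered-≢ i≢j)))
                     (m≤n+m (α m) _)

  lowered-injective : ∀ {i j} → 0 < α i → lowered i ≡ lowered j → i ≡ j
  lowered-injective {i} {j} α>0 eq with i Finₚ.≟ j
  ... | yes i≡j = i≡j
  ... | no  i≢j = contradiction (begin
    ⌊ α i /2⌋            ≡⟨ lookup-lowered i ⟨
    lookup (lowered i) i ≡⟨ cong (λ v → lookup v i) eq ⟩
    lookup (lowered j) i ≡⟨ lookup-lowered-≢ i≢j ⟩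
    α i                  ∎) (<⇒≢ (0<n⇒⌊n/2⌋<n α>0))
    where open ≡-Reasoning

  odd⇒0<α : ∀ {i} → ¬ 2 ∣ α i → 0 < α i
  odd⇒0<α {i} 2∤α = ≤-<-trans z≤n (<-≤-trans (odd⇒⌊n/2⌋<⌈n/2⌉ (α i) 2∤α) (⌈n/2⌉≤n (α i)))

  even⇒lowered-Large : ∀ {i} → 2 ∣ α i → Large (lowered i)
  even⇒lowered-Large {i} 2∣α j with j Finₚ.≟ i
  ... | yes refl = subst (λ x → ⌈ α j /2⌉ ≤ x × x ≤ α j) (sym (lookup-lowered j))
                     (≤-reflexive (even⇒⌈n/2⌉≡⌊n/2⌋ (α j) 2∣α) , ⌊n/2⌋≤n (α j))
  ... | no  j≢i  = subst (λ x → ⌈ α j /2⌉ ≤ x × x ≤ α j) (sym (lookup-lowered-≢ j≢i))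
                     (⌈n/2⌉≤n (α j) , ≤-refl)

  odd⇒lowered-¬Large : ∀ {i} → ¬ 2 ∣ α i → ¬ Large (lowered i)
  odd⇒lowered-¬Large {i} 2∤α lowered-large = <⇒≱ (odd⇒⌊n/2⌋<⌈n/2⌉ (α i) 2∤α)
    (subst (⌈ α i /2⌉ ≤_) (lookup-lowered i) (proj₁ (lowered-large i)))

  odd⇒lowered≢top : ∀ {i} → ¬ 2 ∣ α i → lowered i ≢ top
  odd⇒lowered≢top {i} 2∤α eq = <⇒≢ (0<n⇒⌊n/2⌋<n (odd⇒0<α 2∤α))
    (trans (sym (lookup-lowered i)) (trans (cong (λ v → lookup v i) eq) (lookup-top i)))

  ≢bottom⇒∃0< : ∀ {e} → e ≢ bottom → ∃[ i ] 0 < lookup e i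
  ≢bottom⇒∃0< {e} e≢0 with Finₚ.any? (λ i → 0 <? lookup e i)
  ... | yes e>0 = e>0
  ... | no  e≯0 = contradiction (≡-by-lookup λ i →
          trans (n≤0⇒n≡0 (≮⇒≥ (e≯0 ∘ (i ,_)))) (sym (Vecₚ.lookup-replicate i 0))) e≢0

  ≢top⇒∃< : ∀ {e} → Below e → e ≢ top → ∃[ i ] lookup e i < α i
  ≢top⇒∃< {e} e≤α e≢α with Finₚ.any? (λ i → lookup e i <? α i)
  ... | yes e<α = e<α
  ... | no  e≮α = contradiction (≡-by-lookup λ i →
          trans (≤-antisym (e≤α i) (≮⇒≥ (e≮α ∘ (i ,_)))) (sym (lookup-top i))) e≢α

  Proper⇒Large≢bottom : ∀ {e x} → Proper e → Large x → x ≢ bottom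
  Proper⇒Large≢bottom {e} {x} (e≤α , e≢0 , _) x-large refl with ≢bottom⇒∃0< e≢0
  ... | i , e>0 = n≮0 (subst (0 <_) (Vecₚ.lookup-replicate i 0)
                    (≤-trans (⌈n/2⌉-mono (≤-trans e>0 (e≤α i))) (proj₁ (x-large i))))

  lowered≡bottom⇒ : ∀ {m} → lowered m ≡ bottom → ∀ c → lookup (lowered m) c ≡ 0
  lowered≡bottom⇒ lowered≡0 c = trans (cong (λ v → lookup v c) lowered≡0) (Vecₚ.lookup-replicate c 0)

  -- lowered m = bottom forces α to vanish off m and α m ≤ 1, leaving no room for a proper vector.
  Proper⇒lowered≢bottom : ∀ {e} → Proper e → ∀ m → lowered m ≢ bottom
  Proper⇒lowered≢bottom {e} (e≤α , e≢0 , e≢α) m lowered≡0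
    with ≢bottom⇒∃0< e≢0 | ≢top⇒∃< e≤α e≢α
  ... | i , e>0 | j , e<α with i Finₚ.≟ m | j Finₚ.≟ m
  ... | no i≢m   | _        = <⇒≢ (≤-trans e>0 (e≤α i))
                                (trans (sym (lowered≡bottom⇒ lowered≡0 i)) (lookup-lowered-≢ i≢m))
  ... | yes _    | no j≢m   = n≮0 (subst (lookup e j <_)
                                (trans (sym (lookup-lowered-≢ j≢m)) (lowered≡bottom⇒ lowered≡0 j)) e<α)
  ... | yes refl | yes refl = <⇒≢ (⌊n/2⌋-mono (≤-<-trans e>0 e<α))
                                (trans (sym (lowered≡bottom⇒ lowered≡0 m)) (lookup-lowered m))

  length-upperHalf : ∀ l → (∀ i → toℕ i < l → ¬ 2 ∣ α i) → length upperHalf ≡ prod k (factor k l α)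
  length-upperHalf l odd = trans (length-box (λ i → ⌈ α i /2⌉) α) (prod-cong k side-length)
    where
    side-length : ∀ i → suc (α i ∸ ⌈ α i /2⌉) ≡ factor k l α i
    side-length i with toℕ i <ᵇ l in i<ᵇl | m+n∸n≡m ⌊ α i /2⌋ ⌈ α i /2⌉
    ... | true  | ⌊α/2⌋≡ rewrite ⌊n/2⌋+⌈n/2⌉≡n (α i) = trans (cong suc ⌊α/2⌋≡)
      (sym (odd⇒⌈n/2⌉≡1+⌊n/2⌋ (α i) (odd i (<ᵇ⇒< (toℕ i) l (subst T (sym i<ᵇl) _)))))
    ... | false | ⌊α/2⌋≡ rewrite ⌊n/2⌋+⌈n/2⌉≡n (α i) = trans (cong suc ⌊α/2⌋≡) (+-comm 1 ⌊ α i /2⌋)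

  module Classification (l : ℕ) where

    Small : Vec ℕ k → Fin k → Set
    Small e i = lookup e i < ⌈ α i /2⌉

    small? : ∀ e → Dec (∃ (Small e))
    small? e = Finₚ.any? (λ i → lookup e i <? ⌈ α i /2⌉)

    ψ : Fin k → Vec ℕ k ⊎ Fin l
    ψ i with toℕ i <? l
    ... | yes i<l = inj₂ (fromℕ< i<l)
    ... | no  _   = inj₁ (lowered i)

    φ′ : ∀ e → Dec (∃ (Small e)) → Vec ℕ k ⊎ Fin l
    φ′ e (yes (i , _)) = ψ i
    φ′ e (no  _)       = inj₁ e

    φ : Vec ℕ k → Vec ℕ k ⊎ Fin l
    φ e = φ′ e (small? e)

    ψ-injective : ∀ {i j} → 0 < α i → ψ i ≡ ψ j → i ≡ j
    ψ-injective {i} {j} α>0 eq with toℕ i <? l | toℕ j <? l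
    ... | yes i<l | yes j<l =
      Finₚ.toℕ-injective (Finₚ.fromℕ<-injective _ _ i<l j<l (inj₂-injective eq))
    ... | no  _   | no  _   = lowered-injective α>0 (inj₁-injective eq)

    ψ≡inj₁⇒ : ∀ {i v} → ψ i ≡ inj₁ v → lowered i ≡ v
    ψ≡inj₁⇒ {i} eq with toℕ i <? l
    ... | no _ = inj₁-injective eq

    Small⇒ψ≢inj₁ : ∀ {u v i} → Small u i → Complementary u v → ψ i ≢ inj₁ v
    Small⇒ψ≢inj₁ {u} {v} {i} u-small u+v≥α ψi≡v with ψ≡inj₁⇒ ψi≡v
    ... | refl = <-irrefl (sym (lookup-lowered i)) (<⌈/2⌉∧≤+⇒⌊/2⌋< u-small (u+v≥α i))

    φ′-separates : ∀ {u v} → Joined u v → ∀ du dv → φ′ u du ≢ φ′ v dv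
    φ′-separates (u≢v , _) (no _) (no _) eq = u≢v (inj₁-injective eq)
    φ′-separates {u} {v} (_ , u+v≥α) (yes (i , u-small)) (no _) eq =
      Small⇒ψ≢inj₁ {u} {v} u-small u+v≥α eq
    φ′-separates {u} {v} (_ , u+v≥α) (no _) (yes (j , v-small)) eq =
      Small⇒ψ≢inj₁ {v} {u} v-small (Complementary-sym {u} {v} u+v≥α) (sym eq)
    φ′-separates {u} {v} (_ , u+v≥α) (yes (i , u-small)) (yes (j , v-small)) eq
      with ψ-injective (≤-<-trans z≤n (<-≤-trans u-small (⌈n/2⌉≤n (α i)))) eq
    ... | refl = <-irrefl refl (begin-strict
      suc ⌊ α i /2⌋ ≤⟨ <⌈/2⌉∧≤+⇒⌊/2⌋< u-small (u+v≥α i) ⟩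
      lookup v i    <⟨ v-small ⟩
      ⌈ α i /2⌉     ≤⟨ ⌈n/2⌉≤1+⌊n/2⌋ (α i) ⟩
      suc ⌊ α i /2⌋ ∎)
      where open ≤-Reasoning

    φ-separates : ∀ {u v} → Joined u v → φ u ≢ φ v
    φ-separates {u} {v} u~v = φ′-separates {u} {v} u~v (small? u) (small? v)

    targets : List (Vec ℕ k ⊎ Fin l)
    targets = map inj₁ upperHalf ++ map inj₂ (allFin l)

    length-targets : length targets ≡ length upperHalf + l
    length-targets = trans (Listₚ.length-++ (map inj₁ upperHalf))
      (cong₂ _+_ (Listₚ.length-map inj₁ upperHalf)
        (trans (Listₚ.length-map inj₂ (allFin l)) (Listₚ.length-tabulate (λ i → i))))

    module _ (even : ∀ i → l ≤ toℕ i → 2 ∣ α i) where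

      ψ-∈ : ∀ i → ψ i ∈ targets
      ψ-∈ i with toℕ i <? l
      ... | yes i<l = ∈-++⁺ʳ (map inj₁ upperHalf) (∈-map⁺ inj₂ (∈-allFin _))
      ... | no  i≮l = ∈-++⁺ˡ (∈-map⁺ inj₁ (∈-box⁺ (even⇒lowered-Large (even i (≮⇒≥ i≮l)))))

      φ′-∈ : ∀ {e} → Below e → ∀ de → φ′ e de ∈ targets
      φ′-∈ e≤α (yes (i , _)) = ψ-∈ i
      φ′-∈ e≤α (no  ∄small)  = ∈-++⁺ˡ (∈-map⁺ inj₁ (∈-box⁺ λ i → ≮⇒≥ (∄small ∘ (i ,_)) , e≤α i))

      Joined-length-≤ : ∀ {S} → All Below S → AllPairs Joined S → length S ≤ length upperHalf + l
      Joined-length-≤ {S} S≤α S-joined = begin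
        length S             ≡⟨ Listₚ.length-map φ S ⟨
        length (map φ S)     ≤⟨ Unique-⊆⇒length-≤ φS-unique φS⊆targets ⟩
        length targets       ≡⟨ length-targets ⟩
        length upperHalf + l ∎
        where
        open ≤-Reasoning
        φS-unique : Unique (map φ S)
        φS-unique = AllPairsₚ.map⁺ (AllPairs.map φ-separates S-joined)
        φS⊆targets : ∀ {x} → x ∈ map φ S → x ∈ targets
        φS⊆targets x∈ with ∈-map⁻ φ x∈
        ... | e , e∈S , refl = φ′-∈ {e} (All.lookup S≤α e∈S) (small? e)

  IsProperClique⇒length< : ∀ l → (∀ i → l ≤ toℕ i → 2 ∣ α i) →
                           ∀ {S} → IsProperClique S → length S < length upperHalf + l
  IsProperClique⇒length< l even (S-proper , S-joined) = Classification.Joined-length-≤ l even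
    ((≤-reflexive ∘ lookup-top) ∷ All.map proj₁ S-proper)
    (All.map (λ {e} (_ , _ , e≢top) → e≢top ∘ sym , top-complementary e) S-proper ∷ S-joined)

  module Construction {l} (l≤k : l ≤ k) (odd : ∀ i → toℕ i < l → ¬ 2 ∣ α i)
                      {e₀} (e₀-proper : Proper e₀) where

    ι : Fin l → Fin k
    ι j = inject≤ j l≤k

    odd-ι : ∀ j → ¬ 2 ∣ α (ι j)
    odd-ι j = odd (ι j) (subst (_< l) (sym (Finₚ.toℕ-inject≤ j l≤k)) (Finₚ.toℕ<n j))

    upperHalf-head : ∃[ rest ] upperHalf ≡ top ∷ rest
    upperHalf-head = box-head (λ i → ⌈ α i /2⌉) α (⌈n/2⌉≤n ∘ α)

    rest : List (Vec ℕ k)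
    rest = proj₁ upperHalf-head

    top∷rest-unique : Unique (top ∷ rest)
    top∷rest-unique = subst Unique (proj₂ upperHalf-head) (box-unique _ α)

    rest-Large : All Large rest
    rest-Large = All.tabulate λ {x} x∈rest →
      ∈-box⁻ (⌈n/2⌉≤n ∘ α) (subst (x ∈_) (sym (proj₂ upperHalf-head)) (there x∈rest))

    loweredOdd : List (Vec ℕ k)
    loweredOdd = List.tabulate (lowered ∘ ι)

    clique : List (Vec ℕ k)
    clique = rest ++ loweredOdd

    clique-unique : Unique clique
    clique-unique = Uniqueₚ.++⁺ (AllPairs.tail top∷rest-unique) loweredOdd-unique disjoint
      where
      loweredOdd-unique : Unique loweredOdd
      loweredOdd-unique = Uniqueₚ.tabulate⁺ λ {i} {j} eq →
        Finₚ.inject≤-injective l≤k l≤k i j (lowered-injective (odd⇒0<α (odd-ι i)) eq)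
      disjoint : Disjoint rest loweredOdd
      disjoint (x∈rest , x∈loweredOdd) with ∈-tabulate⁻ x∈loweredOdd
      ... | j , refl = odd⇒lowered-¬Large (odd-ι j) (All.lookup rest-Large x∈rest)

    Kind : Vec ℕ k → Set
    Kind x = Large x ⊎ ∃[ j ] x ≡ lowered (ι j)

    clique-Kind : All Kind clique
    clique-Kind = Allₚ.++⁺ (All.map inj₁ rest-Large) (Allₚ.tabulate⁺ λ j → inj₂ (j , refl))

    Kind-complementary : ∀ {x y} → Kind x → Kind y → x ≢ y → Complementary x y
    Kind-complementary {x} {y} (inj₁ x-large) (inj₁ y-large) _ =
      Large-complementary {x} {y} x-large y-large
    Kind-complementary {x} (inj₁ x-large) (inj₂ (j , refl)) _ =
      Large-lowered-complementary {x} (ι j) x-large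
    Kind-complementary {x} {y} (inj₂ (i , refl)) (inj₁ y-large) _ =
      Complementary-sym {y} {x} (Large-lowered-complementary {y} (ι i) y-large)
    Kind-complementary (inj₂ (i , refl)) (inj₂ (j , refl)) x≢y =
      lowered-complementary (x≢y ∘ cong lowered)

    clique-proper : All Proper clique
    clique-proper = Allₚ.++⁺
      (All.zipWith (λ {x} (x-large , top≢x) →
          Large⇒Below {x} x-large , Proper⇒Large≢bottom {e₀} {x} e₀-proper x-large , top≢x ∘ sym)
        (rest-Large , AllPairs.head top∷rest-unique))
      (Allₚ.tabulate⁺ λ j →
        lowered-Below (ι j) , Proper⇒lowered≢bottom e₀-proper (ι j) , odd⇒lowered≢top (odd-ι j))

    clique-joined : AllPairs Joined clique
    clique-joined = AllPairs.zipWith (λ (x≢y , complementary) → x≢y , complementary x≢y)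
      (clique-unique , All⇒AllPairs Kind-complementary clique-Kind)

    length-clique : suc (length clique) ≡ length upperHalf + l
    length-clique = begin
      suc (length (rest ++ loweredOdd))     ≡⟨ cong suc (Listₚ.length-++ rest) ⟩
      suc (length rest + length loweredOdd) ≡⟨ cong (λ m → suc (length rest + m))
                                                 (Listₚ.length-tabulate (lowered ∘ ι)) ⟩
      length (top ∷ rest) + l               ≡⟨ cong (λ xs → length xs + l) (proj₂ upperHalf-head) ⟨
      length upperHalf + l                  ∎
      where open ≡-Reasoning

  largeProperClique : ∀ {l} → l ≤ k → (∀ i → toℕ i < l → ¬ 2 ∣ α i) → ∃ Proper →
                      ∃[ C ] IsProperClique C × suc (length C) ≡ length upperHalf + l
  largeProperClique l≤k odd (_ , e₀-proper) =
    clique , (clique-proper , clique-joined) , length-clique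
    where open Construction l≤k odd e₀-proper

-- Divisors

module Divisors {n k} {p : Fin k → ℕ} (ps : DistinctPrimes p) {α : Fin k → ℕ}
                (n≡ : n ≡ powProd p α) .{{_ : NonZero n}} where

  open ExponentVectors α

  divisor : Vec ℕ k → ℕ
  divisor e = powProd p (lookup e)

  divisor-∣⇒≤ : ∀ {u v} → divisor u ∣ divisor v → ∀ i → lookup u i ≤ lookup v i
  divisor-∣⇒≤ {u} {v} = powProd-∣⇒≤ ps (lookup u) (lookup v)

  divisor-injective : ∀ {u v} → divisor u ≡ divisor v → u ≡ v
  divisor-injective {u} {v} eq = ≡-by-lookup λ i →
    ≤-antisym (divisor-∣⇒≤ {u} {v} (∣-reflexive eq) i) (divisor-∣⇒≤ {v} {u} (∣-reflexive (sym eq)) i)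

  divisor-top : divisor top ≡ n
  divisor-top = trans (prod-cong k (λ i → cong (p i ^_) (lookup-top i))) (sym n≡)

  divisor-bottom : divisor bottom ≡ 1
  divisor-bottom =
    trans (prod-cong k (λ i → cong (p i ^_) (Vecₚ.lookup-replicate i 0))) (powProd-zero p)

  divisor-* : ∀ u v → divisor u * divisor v ≡ powProd p (λ i → lookup u i + lookup v i)
  divisor-* u v = sym (powProd-+ p (lookup u) (lookup v))

  Proper⇒ProperDivisor : ∀ {e} → Proper e → ProperDivisor n (divisor e)
  Proper⇒ProperDivisor {e} (e≤α , e≢bottom , e≢top) = 1<d , d<n , d∣n
    where
    d∣n : divisor e ∣ n
    d∣n = subst (divisor e ∣_) (sym n≡) (powProd-monoʳ-∣ p e≤α)
    d≢0 : divisor e ≢ 0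
    d≢0 d≡0 = ≢-nonZero⁻¹ n (0∣⇒≡0 (subst (_∣ n) d≡0 d∣n))
    1<d : 1 < divisor e
    1<d = ≤∧≢⇒< (n≢0⇒n>0 d≢0)
      (λ 1≡d → e≢bottom (divisor-injective {e} {bottom} (trans (sym 1≡d) (sym divisor-bottom))))
    d<n : divisor e < n
    d<n = ≤∧≢⇒< (∣⇒≤ d∣n)
      (λ d≡n → e≢top (divisor-injective {e} {top} (trans d≡n (sym divisor-top))))

  ProperDivisor⇒Proper : ∀ {d} → ProperDivisor n d → ∃[ e ] Proper e × d ≡ divisor e
  ProperDivisor⇒Proper {d} (1<d , d<n , d∣n) with ∣powProd⇒ ps α d (subst (d ∣_) n≡ d∣n)
  ... | e , e≤α , refl = e , (e≤α , e≢bottom , e≢top) , refl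
    where
    e≢bottom : e ≢ bottom
    e≢bottom refl = <⇒≢ 1<d (sym divisor-bottom)
    e≢top : e ≢ top
    e≢top refl = <⇒≢ d<n divisor-top

  Composite⇒∃Proper : Composite n → ∃ Proper
  Composite⇒∃Proper (composite {d} d<n d∣n) with ProperDivisor⇒Proper (nonTrivial⇒n>1 d , d<n , d∣n)
  ... | e , e-proper , _ = e , e-proper

  Joined⇒Adjacent : ∀ {u v} → Joined u v → Adjacent n (divisor u) (divisor v)
  Joined⇒Adjacent {u} {v} (u≢v , u+v≥α) = u≢v ∘ divisor-injective ,
    subst₂ _∣_ (sym n≡) (sym (divisor-* u v)) (powProd-monoʳ-∣ p u+v≥α)

  Adjacent⇒Joined : ∀ {u v} → Adjacent n (divisor u) (divisor v) → Joined u v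
  Adjacent⇒Joined {u} {v} (du≢dv , n∣du*dv) = du≢dv ∘ cong divisor ,
    powProd-∣⇒≤ ps α (λ i → lookup u i + lookup v i) (subst₂ _∣_ n≡ (divisor-* u v) n∣du*dv)

  IsProperClique⇒IsClique : ∀ {C} → IsProperClique C → IsClique n (map divisor C)
  IsProperClique⇒IsClique (C-proper , C-joined) =
    Allₚ.map⁺ (All.map Proper⇒ProperDivisor C-proper) ,
    AllPairsₚ.map⁺ (AllPairs.map Joined⇒Adjacent C-joined)

  IsClique⇒IsProperClique : ∀ {S} → IsClique n S → ∃[ C ] IsProperClique C × map divisor C ≡ S
  IsClique⇒IsProperClique (S-proper , S-adjacent)
    with All-preimage divisor (All.map ProperDivisor⇒Proper S-proper)
  ... | C , C-proper , refl =
    C , (C-proper , AllPairs.map Adjacent⇒Joined (AllPairsₚ.map⁻ S-adjacent)) , refl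

proposition5p1 : (n : ℕ) → Composite n → (∀ q → Prime q → n ≢ q * q) →
    (k : ℕ) (p α : Fin k → ℕ) (l : ℕ) → l ≤ k →
    (∀ i → Prime (p i)) → Injective _≡_ _≡_ p → (∀ i → 1 ≤ α i) →
    n ≡ prod k (λ i → p i ^ α i) →
    (∀ i → toℕ i < l → ¬ (2 ∣ α i)) →
    (∀ i → l ≤ toℕ i → 2 ∣ α i) →
    CliqueNumber n (prod k (factor k l α) + l ∸ 1)
proposition5p1 n n-composite _ k p α l l≤k p-prime p-injective _ n≡ odd even =
  lower (largeProperClique l≤k odd (Composite⇒∃Proper n-composite)) ,
  λ S S-clique → upper (IsClique⇒IsProperClique S-clique)
  where
  instance
    n≢0 : NonZero n
    n≢0 = composite⇒nonZero n-composite
  p-distinct : DistinctPrimes p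
  p-distinct = record { prime = p-prime ; injective = p-injective }
  open ExponentVectors α
  open Divisors p-distinct {α} n≡
  open ≤-Reasoning

  ω = prod k (factor k l α) + l ∸ 1

  ω-upperHalf : length upperHalf + l ∸ 1 ≡ ω
  ω-upperHalf = cong (λ m → m + l ∸ 1) (length-upperHalf l odd)

  lower : ∃[ C ] IsProperClique C × suc (length C) ≡ length upperHalf + l →
          ∃[ S ] IsClique n S × length S ≡ ω
  lower (C , C-clique , length-C) = map divisor C , IsProperClique⇒IsClique C-clique ,
    trans (Listₚ.length-map divisor C) (trans (cong (_∸ 1) length-C) ω-upperHalf)

  upper : ∀ {S} → ∃[ C ] IsProperClique C × map divisor C ≡ S → length S ≤ ω
  upper (C , C-clique , refl) = begin
    length (map divisor C)   ≡⟨ Listₚ.length-map divisor C ⟩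
    suc (length C) ∸ 1       ≤⟨ ∸-monoˡ-≤ 1 (IsProperClique⇒length< l even C-clique) ⟩
    length upperHalf + l ∸ 1 ≡⟨ ω-upperHalf ⟩
    ω                        ∎
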